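{- Let $p_1,\dots,p_s$ ($s\ge1$) be distinct primes, let $\alpha_1,\dots,\alpha_s\ge 1$ be integers, and let $k\ge n\ge 1$ be integers. The following are equivalent: \begin{enumerate} \item $\prod_{i=1}^s p_i^{\alpha_i+\lfloor \log_{p_i}(n)\rfloor}$ divides $k$; \item for all $1\le i\le s$ and all $1\le j\le n$, $v_{p_i}\left(\binom{k}{j}\right)\ge \alpha_i$; equivalently, $\prod_{i=1}^s p_i^{\alpha_i}$ divides $\binom{k}{j}$ for all $1\le j\le n$. \end{enumerate}
   Context: $v_p$ denotes the $p$-adic valuation on integers. -}

module Defs where

open import Data.Nat using (ℕ; zero; suc; _*_; _^_; _≤?_)
open import Data.Fin using (Fin; zero; suc)
open import Relation.Nullary.Decidable using (does)
open import Data.Bool using (if_then_else_)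

∏ : ∀ {s} → (Fin s → ℕ) → ℕ
∏ {zero}  f = 1
∏ {suc s} f = f zero * ∏ (λ i → f (suc i))

-- Search over e ∈ {0,…,n} (sufficient since p ^ e ≥ 2 ^ e > e for p ≥ 2),
-- returning the largest such e (0 if none, which cannot happen for n ≥ 1).
flogSearch : ℕ → ℕ → ℕ → ℕ
flogSearch p n zero    = 0
flogSearch p n (suc e) = if does (p ^ suc e ≤? n) then suc e else flogSearch p n e

⌊log_⌋ : ℕ → ℕ → ℕ
⌊log p ⌋ n = flogSearch p n n

-- Fix one prime p and put L = ⌊log_p n⌋. The identity j·C(k,j) = k·C(k−1,j−1) gives
-- v_p(C(k,j)) ≥ v_p(k) − v_p(j) ≥ v_p(k) − L for 1 ≤ j ≤ n, hence (1) ⇒ (2). Conversely, if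
-- p^e ∣ k then p ∤ C(k−1,i) for every i < p^e (induction on i along
-- (i+1)·C(k−1,i+1) = (k−1−i)·C(k−1,i)), so v_p(C(k,p^e)) = v_p(k) − e exactly. Applying (2)
-- to j = p^e with e = min(v_p(k), L) gives α ≤ v_p(k) − e; as α ≥ 1 this forces e = L, i.e.
-- α + L ≤ v_p(k). Finally, powers of distinct primes divide k iff their product does.

module Submission where

open import Defs
open import Data.Nat using (ℕ; _+_; _^_; _≤_)
open import Data.Nat.Divisibility using (_∣_)
open import Data.Nat.Primality using (Prime)
open import Data.Nat.Combinatorics using (_C_)
open import Data.Fin using (Fin)
open import Function.Bundles using (_⇔_)
open import Function.Definitions using (Injective)
open import Relation.Binary.PropositionalEquality using (_≡_)

open import Data.Nat
  using (zero; suc; pred; _*_; _∸_; _<_; _<?_; _≤ᵇ_; z≤n; s≤s;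
         NonZero; >-nonZero; ≢-nonZero; ≢-nonZero⁻¹; nonTrivial⇒n>1)
open import Data.Nat.Properties
open import Data.Nat.Divisibility
  using (divides; _∣0; ∣-trans; 1∣_; ∣1⇒≡1; m∣m*n; n∣m*n; ∣⇒≤; _∣?_;
         *-cancelˡ-∣; *-monoʳ-∣; *-monoˡ-∣; ∣m+n∣m⇒∣n; m∣n⇒n≡quotient*m; quotient)
open import Data.Nat.Primality
  using (euclidsLemma; prime⇒nonZero; prime⇒nonTrivial; prime⇒irreducible)
open import Data.Nat.Combinatorics using (nC1≡n; nCk+nC[k+1]≡[n+1]C[k+1])
open import Data.Nat.Induction using (<-wellFounded)
open import Data.Nat.Tactic.RingSolver using (solve-∀)
open import Data.Fin using (zero; suc)
open import Data.Fin.Properties using () renaming (0≢1+n to Fin-0≢1+n; suc-injective to Fin-suc-injective)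
open import Data.Product using (Σ-syntax; _×_; _,_)
open import Data.Sum using (inj₁; inj₂)
open import Data.Bool using (true; false)
open import Relation.Nullary.Reflects using (ofʸ; ofⁿ)
open import Function.Bundles using (mk⇔)
open import Induction.WellFounded using (Acc; acc)
open import Relation.Nullary using (¬_; yes; no; contradiction)
open import Relation.Binary.PropositionalEquality
  using (_≢_; refl; sym; trans; cong; cong₂; subst; subst₂; module ≡-Reasoning)

[1+k]*[1+n]C[1+k]≡[1+n]*nCk : ∀ n k → suc k * (suc n C suc k) ≡ suc n * (n C k)
[1+k]*[1+n]C[1+k]≡[1+n]*nCk zero    zero    = refl
[1+k]*[1+n]C[1+k]≡[1+n]*nCk zero    (suc k) = *-zeroʳ (suc (suc k))
[1+k]*[1+n]C[1+k]≡[1+n]*nCk (suc n) zero    =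
  trans (*-identityˡ (suc (suc n) C 1)) (trans (nC1≡n (suc (suc n))) (sym (*-identityʳ (suc (suc n)))))
[1+k]*[1+n]C[1+k]≡[1+n]*nCk (suc n) (suc k) = begin
  suc (suc k) * (suc (suc n) C suc (suc k))   ≡⟨ cong (suc (suc k) *_) (sym (nCk+nC[k+1]≡[n+1]C[k+1] (suc n) (suc k))) ⟩
  suc (suc k) * (A + B)                       ≡⟨ regroup A B (suc k) ⟩
  A + (suc k * A + suc (suc k) * B)           ≡⟨ cong₂ (λ x y → A + (x + y))
                                                   ([1+k]*[1+n]C[1+k]≡[1+n]*nCk n k)
                                                   ([1+k]*[1+n]C[1+k]≡[1+n]*nCk n (suc k)) ⟩
  A + (suc n * (n C k) + suc n * (n C suc k)) ≡⟨ cong (A +_) (sym (*-distribˡ-+ (suc n) (n C k) _)) ⟩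
  A + suc n * (n C k + n C suc k)             ≡⟨ cong (λ x → A + suc n * x) (nCk+nC[k+1]≡[n+1]C[k+1] n k) ⟩
  suc (suc n) * A                             ∎
  where
  open ≡-Reasoning
  A = suc n C suc k
  B = suc n C suc (suc k)
  regroup : ∀ a b c → suc c * (a + b) ≡ a + (c * a + suc c * b)
  regroup = solve-∀

[1+k]*nC[1+k]≡[n∸k]*nCk : ∀ n k → suc k * (n C suc k) ≡ (n ∸ k) * (n C k)
[1+k]*nC[1+k]≡[n∸k]*nCk n k = begin
  suc k * Y                             ≡⟨ sym (m+n∸m≡n (suc k * X) (suc k * Y)) ⟩
  (suc k * X + suc k * Y) ∸ suc k * X   ≡⟨ cong (_∸ suc k * X) (sym (*-distribˡ-+ (suc k) X Y)) ⟩
  suc k * (X + Y) ∸ suc k * X           ≡⟨ cong (λ z → suc k * z ∸ suc k * X) (nCk+nC[k+1]≡[n+1]C[k+1] n k) ⟩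
  suc k * (suc n C suc k) ∸ suc k * X   ≡⟨ cong (_∸ suc k * X) ([1+k]*[1+n]C[1+k]≡[1+n]*nCk n k) ⟩
  suc n * X ∸ suc k * X                 ≡⟨ sym (*-distribʳ-∸ X (suc n) (suc k)) ⟩
  (n ∸ k) * X                           ∎
  where
  open ≡-Reasoning
  X = n C k
  Y = n C suc k

^-monoʳ-∣ : ∀ m {a b} → a ≤ b → m ^ a ∣ m ^ b
^-monoʳ-∣ m {a} {b} a≤b = divides (m ^ (b ∸ a)) (begin
  m ^ b               ≡⟨ cong (m ^_) (sym (m+[n∸m]≡n a≤b)) ⟩
  m ^ (a + (b ∸ a))   ≡⟨ ^-distribˡ-+-* m a (b ∸ a) ⟩
  m ^ a * m ^ (b ∸ a) ≡⟨ *-comm (m ^ a) _ ⟩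
  m ^ (b ∸ a) * m ^ a ∎)
  where open ≡-Reasoning

n<m^n : ∀ {m} → 1 < m → ∀ n → n < m ^ n
n<m^n 1<m zero        = s≤s z≤n
n<m^n {m} 1<m (suc n) = begin-strict
  1 + n             <⟨ +-mono-≤-< (m^n>0 m n) (n<m^n 1<m n) ⟩
  m ^ n + m ^ n     ≡⟨ cong (m ^ n +_) (sym (+-identityʳ (m ^ n))) ⟩
  2 * m ^ n         ≤⟨ *-monoˡ-≤ (m ^ n) 1<m ⟩
  m * m ^ n         ∎
  where
  open ≤-Reasoning
  instance _ = >-nonZero (<-trans (s≤s z≤n) 1<m)

^-cancelʳ-< : ∀ m .{{_ : NonZero m}} {a b} → m ^ a < m ^ b → a < b
^-cancelʳ-< m {a} {b} m^a<m^b with a <? b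
... | yes a<b = a<b
... | no  a≮b = contradiction (^-monoʳ-≤ m (≮⇒≥ a≮b)) (<⇒≱ m^a<m^b)

flogSearch-maximal : ∀ p n N {e} → e ≤ N → p ^ e ≤ n → e ≤ flogSearch p n N
flogSearch-maximal p n zero    e≤0 _ = e≤0
flogSearch-maximal p n (suc N) e≤1+N p^e≤n with p ^ suc N ≤ᵇ n | ≤ᵇ-reflects-≤ (p ^ suc N) n
... | true  | _ = e≤1+N
... | false | ofⁿ p^[1+N]≰n with m≤n⇒m<n∨m≡n e≤1+N
...   | inj₁ e<1+N = flogSearch-maximal p n N (≤-pred e<1+N) p^e≤n
...   | inj₂ refl  = contradiction p^e≤n p^[1+N]≰n

p^flogSearch≤n : ∀ p {n} N → 1 ≤ n → p ^ flogSearch p n N ≤ n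
p^flogSearch≤n p zero    1≤n = 1≤n
p^flogSearch≤n p {n} (suc N) 1≤n with p ^ suc N ≤ᵇ n | ≤ᵇ-reflects-≤ (p ^ suc N) n
... | true  | ofʸ p^[1+N]≤n = p^[1+N]≤n
... | false | _             = p^flogSearch≤n p N 1≤n

p^e≤n⇒e≤⌊log⌋n : ∀ {p} → 1 < p → ∀ {n e} → p ^ e ≤ n → e ≤ ⌊log p ⌋ n
p^e≤n⇒e≤⌊log⌋n {p} 1<p {n} {e} p^e≤n = flogSearch-maximal p n n (<⇒≤ (<-≤-trans (n<m^n 1<p e) p^e≤n)) p^e≤n

p^⌊log⌋n≤n : ∀ p {n} → 1 ≤ n → p ^ ⌊log p ⌋ n ≤ n
p^⌊log⌋n≤n p {n} = p^flogSearch≤n p n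

record Valuation (p n : ℕ) : Set where
  field
    exponent              : ℕ
    cofactor              : ℕ
    n≡p^exponent*cofactor : n ≡ p ^ exponent * cofactor
    p∤cofactor            : ¬ p ∣ cofactor

  p^exponent∣n : p ^ exponent ∣ n
  p^exponent∣n = divides cofactor (trans n≡p^exponent*cofactor (*-comm (p ^ exponent) cofactor))

  n≡p^e*p^[exponent∸e]*cofactor : ∀ {e} → e ≤ exponent → n ≡ p ^ e * (p ^ (exponent ∸ e) * cofactor)
  n≡p^e*p^[exponent∸e]*cofactor {e} e≤exponent = begin
    n                                           ≡⟨ n≡p^exponent*cofactor ⟩
    p ^ exponent * cofactor                     ≡⟨ cong (λ x → p ^ x * cofactor) (sym (m+[n∸m]≡n e≤exponent)) ⟩
    p ^ (e + (exponent ∸ e)) * cofactor         ≡⟨ cong (_* cofactor) (^-distribˡ-+-* p e (exponent ∸ e)) ⟩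
    p ^ e * p ^ (exponent ∸ e) * cofactor       ≡⟨ *-assoc (p ^ e) (p ^ (exponent ∸ e)) cofactor ⟩
    p ^ e * (p ^ (exponent ∸ e) * cofactor)     ∎
    where open ≡-Reasoning

valuation : ∀ {p} → 1 < p → ∀ n → .{{NonZero n}} → Valuation p n
valuation {p} 1<p n = go n (<-wellFounded n)
  where
  go : ∀ n → .{{NonZero n}} → Acc _<_ n → Valuation p n
  go n (acc rec) with p ∣? n
  ... | no p∤n = record
    { exponent = 0 ; cofactor = n ; n≡p^exponent*cofactor = sym (+-identityʳ n) ; p∤cofactor = p∤n }
  ... | yes (divides q n≡q*p) = record
    { exponent = suc exponent ; cofactor = cofactor
    ; n≡p^exponent*cofactor = n≡p^[1+exponent]*cofactor ; p∤cofactor = p∤cofactor }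
    where
    instance _ = ≢-nonZero λ { refl → ≢-nonZero⁻¹ n n≡q*p }
    q<n : q < n
    q<n = subst (q <_) (sym n≡q*p) (m<m*n q p 1<p)
    open Valuation (go q (rec q<n))
    n≡p^[1+exponent]*cofactor : n ≡ p ^ suc exponent * cofactor
    n≡p^[1+exponent]*cofactor = begin
      n                             ≡⟨ n≡q*p ⟩
      q * p                         ≡⟨ cong (_* p) n≡p^exponent*cofactor ⟩
      p ^ exponent * cofactor * p   ≡⟨ *-comm (p ^ exponent * cofactor) p ⟩
      p * (p ^ exponent * cofactor) ≡⟨ *-assoc p (p ^ exponent) cofactor ⟨
      p ^ suc exponent * cofactor   ∎
      where open ≡-Reasoning

module _ {p} (p-prime : Prime p) where

  private
    instance
      p≢0 : NonZero p
      p≢0 = prime⇒nonZero p-prime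

    1<p : 1 < p
    1<p = nonTrivial⇒n>1 p {{prime⇒nonTrivial p-prime}}

  p∤1 : ¬ p ∣ 1
  p∤1 p∣1 = <⇒≢ 1<p (sym (∣1⇒≡1 p∣1))

  p∤b⇒p^m∣a*b⇒p^m∣a : ∀ {b} m {a} → ¬ p ∣ b → p ^ m ∣ a * b → p ^ m ∣ a
  p∤b⇒p^m∣a*b⇒p^m∣a zero    p∤b _ = 1∣ _
  p∤b⇒p^m∣a*b⇒p^m∣a {b} (suc m) {a} p∤b p^[1+m]∣a*b
    with euclidsLemma a b p-prime (∣-trans (m∣m*n (p ^ m)) p^[1+m]∣a*b)
  ... | inj₂ p∣b = contradiction p∣b p∤b
  ... | inj₁ (divides a′ refl) = subst (p ^ suc m ∣_) (*-comm p a′) (*-monoʳ-∣ p p^m∣a′)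
    where
    p^m∣a′ : p ^ m ∣ a′
    p^m∣a′ = p∤b⇒p^m∣a*b⇒p^m∣a m p∤b
      (*-cancelˡ-∣ p (subst (p * p ^ m ∣_) (trans (cong (_* b) (*-comm a′ p)) (*-assoc p a′ b)) p^[1+m]∣a*b))

  p∤w⇒p^α∣p^d*w⇒α≤d : ∀ {α d w} → ¬ p ∣ w → p ^ α ∣ p ^ d * w → α ≤ d
  p∤w⇒p^α∣p^d*w⇒α≤d {α} {d} {w} p∤w p^α∣p^d*w with α ≤? d
  ... | yes α≤d = α≤d
  ... | no  α≰d = contradiction (*-cancelˡ-∣ (p ^ d) {{m^n≢0 p d}} p^d*p∣p^d*w) p∤w
    where
    p^d*p∣p^d*w : p ^ d * p ∣ p ^ d * w
    p^d*p∣p^d*w = ∣-trans (subst (_∣ p ^ α) (*-comm p (p ^ d)) (^-monoʳ-∣ p (≰⇒> α≰d))) p^α∣p^d*w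

  p^e∣1+K⇒p∤KCi : ∀ {e K} → p ^ e ∣ suc K → ∀ i → i < p ^ e → ¬ p ∣ K C i
  p^e∣1+K⇒p∤KCi _ zero _ = p∤1
  p^e∣1+K⇒p∤KCi {e} {K} p^e∣1+K (suc i) 1+i<p^e p∣KC[1+i] = p∤cofactor p∣cofactor
    where
    open Valuation (valuation 1<p (suc i))
    instance _ = m^n≢0 p exponent

    p∤KCi : ¬ p ∣ K C i
    p∤KCi = p^e∣1+K⇒p∤KCi {e} p^e∣1+K i (<⇒≤ 1+i<p^e)

    1+v≤e : suc exponent ≤ e
    1+v≤e = ^-cancelʳ-< p (≤-<-trans (∣⇒≤ p^exponent∣n) 1+i<p^e)

    i≤K : i ≤ K
    i≤K = <⇒≤ (≤-pred (<-≤-trans 1+i<p^e (∣⇒≤ p^e∣1+K)))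

    p^[1+v]∣[K∸i]*KCi : p ^ suc exponent ∣ (K ∸ i) * (K C i)
    p^[1+v]∣[K∸i]*KCi = subst₂ _∣_ (*-comm (p ^ exponent) p) p^v*a*X≡[K∸i]*KCi
      (*-monoʳ-∣ (p ^ exponent) (∣-trans p∣KC[1+i] (n∣m*n cofactor)))
      where
      p^v*a*X≡[K∸i]*KCi : p ^ exponent * (cofactor * (K C suc i)) ≡ (K ∸ i) * (K C i)
      p^v*a*X≡[K∸i]*KCi = begin
        p ^ exponent * (cofactor * (K C suc i)) ≡⟨ *-assoc (p ^ exponent) cofactor _ ⟨
        p ^ exponent * cofactor * (K C suc i)   ≡⟨ cong (_* (K C suc i)) n≡p^exponent*cofactor ⟨
        suc i * (K C suc i)                     ≡⟨ [1+k]*nC[1+k]≡[n∸k]*nCk K i ⟩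
        (K ∸ i) * (K C i)                       ∎
        where open ≡-Reasoning

    p^[1+v]∣1+i : p ^ suc exponent ∣ suc i
    p^[1+v]∣1+i = ∣m+n∣m⇒∣n
      (subst (p ^ suc exponent ∣_) (sym (trans (+-suc (K ∸ i) i) (cong suc (m∸n+n≡m i≤K))))
        (∣-trans (^-monoʳ-∣ p 1+v≤e) p^e∣1+K))
      (p∤b⇒p^m∣a*b⇒p^m∣a (suc exponent) p∤KCi p^[1+v]∣[K∸i]*KCi)

    p∣cofactor : p ∣ cofactor
    p∣cofactor = *-cancelˡ-∣ (p ^ exponent) (subst₂ _∣_ (*-comm p (p ^ exponent)) n≡p^exponent*cofactor p^[1+v]∣1+i)

  C[1+K,p^e]-valuation : ∀ {K e} (V : Valuation p (suc K)) → e ≤ Valuation.exponent V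
    → Σ[ w ∈ ℕ ] (suc K C p ^ e ≡ p ^ (Valuation.exponent V ∸ e) * w) × ¬ p ∣ w
  C[1+K,p^e]-valuation {K} {e} V e≤exponent = cofactor * (K C i) , C≡p^[exponent∸e]*w , p∤w
    where
    open Valuation V
    instance _ = m^n≢0 p e
    i = pred (p ^ e)

    C≡p^[exponent∸e]*w : suc K C p ^ e ≡ p ^ (exponent ∸ e) * (cofactor * (K C i))
    C≡p^[exponent∸e]*w = *-cancelˡ-≡ _ _ (p ^ e) (begin
      p ^ e * (suc K C p ^ e)                              ≡⟨ cong (λ j → j * (suc K C j)) (suc-pred (p ^ e)) ⟨
      suc i * (suc K C suc i)                              ≡⟨ [1+k]*[1+n]C[1+k]≡[1+n]*nCk K i ⟩
      suc K * (K C i)                                      ≡⟨ cong (_* (K C i)) (n≡p^e*p^[exponent∸e]*cofactor e≤exponent) ⟩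
      p ^ e * (p ^ (exponent ∸ e) * cofactor) * (K C i)    ≡⟨ regroup (p ^ e) (p ^ (exponent ∸ e)) cofactor (K C i) ⟩
      p ^ e * (p ^ (exponent ∸ e) * (cofactor * (K C i)))  ∎)
      where
      open ≡-Reasoning
      regroup : ∀ a b c d → a * (b * c) * d ≡ a * (b * (c * d))
      regroup = solve-∀

    p∤w : ¬ p ∣ cofactor * (K C i)
    p∤w p∣w with euclidsLemma cofactor (K C i) p-prime p∣w
    ... | inj₁ p∣cofactor = p∤cofactor p∣cofactor
    ... | inj₂ p∣KCi      = p^e∣1+K⇒p∤KCi {e} (∣-trans (^-monoʳ-∣ p e≤exponent) p^exponent∣n) i
                              (≤-reflexive (suc-pred (p ^ e))) p∣KCi

  p^[α+⌊log⌋n]∣k⇒p^α∣kCj : ∀ α {n k} → p ^ (α + ⌊log p ⌋ n) ∣ k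
    → ∀ j → 1 ≤ j → j ≤ n → p ^ α ∣ k C j
  p^[α+⌊log⌋n]∣k⇒p^α∣kCj α {k = zero}  _ (suc i) _ _ = _ ∣0
  p^[α+⌊log⌋n]∣k⇒p^α∣kCj α {n} {suc K} p^[α+L]∣k (suc i) _ 1+i≤n =
    p∤b⇒p^m∣a*b⇒p^m∣a α p∤cofactor (*-cancelˡ-∣ (p ^ exponent) p^v*p^α∣p^v*[X*a])
    where
    open Valuation (valuation 1<p (suc i))
    instance _ = m^n≢0 p exponent

    v≤L : exponent ≤ ⌊log p ⌋ n
    v≤L = p^e≤n⇒e≤⌊log⌋n 1<p (≤-trans (∣⇒≤ p^exponent∣n) 1+i≤n)

    [1+K]*KCi≡p^v*[X*a] : suc K * (K C i) ≡ p ^ exponent * ((suc K C suc i) * cofactor)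
    [1+K]*KCi≡p^v*[X*a] = begin
      suc K * (K C i)                            ≡⟨ [1+k]*[1+n]C[1+k]≡[1+n]*nCk K i ⟨
      suc i * (suc K C suc i)                    ≡⟨ cong (_* (suc K C suc i)) n≡p^exponent*cofactor ⟩
      p ^ exponent * cofactor * (suc K C suc i)  ≡⟨ regroup (p ^ exponent) cofactor (suc K C suc i) ⟩
      p ^ exponent * ((suc K C suc i) * cofactor) ∎
      where
      open ≡-Reasoning
      regroup : ∀ a b c → a * b * c ≡ a * (c * b)
      regroup = solve-∀

    p^v*p^α∣p^v*[X*a] : p ^ exponent * p ^ α ∣ p ^ exponent * ((suc K C suc i) * cofactor)
    p^v*p^α∣p^v*[X*a] = subst₂ _∣_ (^-distribˡ-+-* p exponent α) [1+K]*KCi≡p^v*[X*a]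
      (∣-trans (^-monoʳ-∣ p v+α≤α+L) (∣-trans p^[α+L]∣k (m∣m*n (K C i))))
      where
      v+α≤α+L : exponent + α ≤ α + ⌊log p ⌋ n
      v+α≤α+L = ≤-trans (+-monoˡ-≤ α v≤L) (≤-reflexive (+-comm _ α))

  p^α∣kCj⇒p^[α+⌊log⌋n]∣k : ∀ α {n k} → 1 ≤ α → 1 ≤ n → n ≤ k
    → (∀ j → 1 ≤ j → j ≤ n → p ^ α ∣ k C j) → p ^ (α + ⌊log p ⌋ n) ∣ k
  p^α∣kCj⇒p^[α+⌊log⌋n]∣k α {k = zero} _ 1≤n n≤0 _ = contradiction (≤-trans 1≤n n≤0) λ ()
  p^α∣kCj⇒p^[α+⌊log⌋n]∣k α {n} {suc K} 1≤α 1≤n _ p^α∣kCj = ∣-trans (^-monoʳ-∣ p α+L≤v) p^exponent∣n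
    where
    V = valuation 1<p (suc K)
    open Valuation V
    L = ⌊log p ⌋ n

    α≤v∸e : ∀ {e} → e ≤ exponent → e ≤ L → α ≤ exponent ∸ e
    α≤v∸e {e} e≤v e≤L with C[1+K,p^e]-valuation {e = e} V e≤v
    ... | w , C≡p^[v∸e]*w , p∤w = p∤w⇒p^α∣p^d*w⇒α≤d p∤w (subst (p ^ α ∣_) C≡p^[v∸e]*w
          (p^α∣kCj (p ^ e) (m^n>0 p e) (≤-trans (^-monoʳ-≤ p e≤L) (p^⌊log⌋n≤n p 1≤n))))

    α+L≤v : α + L ≤ exponent
    α+L≤v with exponent ≤? L
    ... | yes v≤L = contradiction (≤-trans 1≤α (subst (α ≤_) (n∸n≡0 exponent) (α≤v∸e ≤-refl v≤L))) λ ()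
    ... | no  v≰L = subst (α + L ≤_) (m∸n+n≡m L≤v) (+-monoˡ-≤ L (α≤v∸e L≤v ≤-refl))
      where L≤v = <⇒≤ (≰⇒> v≰L)

  p∤q^b : ∀ {q} → Prime q → p ≢ q → ∀ b → ¬ p ∣ q ^ b
  p∤q^b q-prime p≢q zero = p∤1
  p∤q^b {q} q-prime p≢q (suc b) p∣q^[1+b] with euclidsLemma q (q ^ b) p-prime p∣q^[1+b]
  ... | inj₂ p∣q^b = p∤q^b q-prime p≢q b p∣q^b
  ... | inj₁ p∣q with prime⇒irreducible q-prime p∣q
  ...   | inj₁ p≡1 = <⇒≢ 1<p (sym p≡1)
  ...   | inj₂ p≡q = p≢q p≡q

  p∤∏ : ∀ {s} (f : Fin s → ℕ) → (∀ i → ¬ p ∣ f i) → ¬ p ∣ ∏ f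
  p∤∏ {zero}  f _ = p∤1
  p∤∏ {suc s} f p∤f p∣∏f with euclidsLemma (f zero) (∏ (λ i → f (suc i))) p-prime p∣∏f
  ... | inj₁ p∣f0 = p∤f zero p∣f0
  ... | inj₂ p∣∏f′ = p∤∏ (λ i → f (suc i)) (λ i → p∤f (suc i)) p∣∏f′

f∣∏f : ∀ {s} (f : Fin s → ℕ) i → f i ∣ ∏ f
f∣∏f f zero    = m∣m*n _
f∣∏f f (suc i) = ∣-trans (f∣∏f (λ i → f (suc i)) i) (n∣m*n (f zero))

∀p^β∣k⇒∏p^β∣k : ∀ {s} {p : Fin s → ℕ} → (∀ i → Prime (p i)) → Injective _≡_ _≡_ p
  → (β : Fin s → ℕ) → ∀ {k} → (∀ i → p i ^ β i ∣ k) → ∏ (λ i → p i ^ β i) ∣ k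
∀p^β∣k⇒∏p^β∣k {zero} _ _ _ _ = 1∣ _
∀p^β∣k⇒∏p^β∣k {suc s} {p} primes p-injective β {k} p^β∣k =
  subst (p zero ^ β zero * ∏′ ∣_) (sym k≡c*∏′) (*-monoˡ-∣ ∏′ p0^β0∣c)
  where
  ∏′ = ∏ (λ i → p (suc i) ^ β (suc i))
  ∏′∣k : ∏′ ∣ k
  ∏′∣k = ∀p^β∣k⇒∏p^β∣k (λ i → primes (suc i)) (λ eq → Fin-suc-injective (p-injective eq))
           (λ i → β (suc i)) (λ i → p^β∣k (suc i))
  c = quotient ∏′∣k
  k≡c*∏′ : k ≡ c * ∏′
  k≡c*∏′ = m∣n⇒n≡quotient*m ∏′∣k
  p0∤∏′ : ¬ p zero ∣ ∏′
  p0∤∏′ = p∤∏ (primes zero) _ λ i →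
    p∤q^b (primes zero) (primes (suc i)) (λ eq → Fin-0≢1+n (p-injective eq)) (β (suc i))
  p0^β0∣c : p zero ^ β zero ∣ c
  p0^β0∣c = p∤b⇒p^m∣a*b⇒p^m∣a (primes zero) (β zero) p0∤∏′
    (subst (p zero ^ β zero ∣_) k≡c*∏′ (p^β∣k zero))

lemma2p4 : (s : ℕ) → 1 ≤ s → (p : Fin s → ℕ) → (∀ i → Prime (p i)) → Injective _≡_ _≡_ p
    → (α : Fin s → ℕ) → (∀ i → 1 ≤ α i) → (n k : ℕ) → 1 ≤ n → n ≤ k
    → (∏ (λ i → p i ^ (α i + ⌊log p i ⌋ n)) ∣ k)
      ⇔ (∀ i (j : ℕ) → 1 ≤ j → j ≤ n → p i ^ α i ∣ k C j)
lemma2p4 s _ p primes p-injective α 1≤α n k 1≤n n≤k = mk⇔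
  (λ ∏∣k i → p^[α+⌊log⌋n]∣k⇒p^α∣kCj (primes i) (α i) (∣-trans (f∣∏f _ i) ∏∣k))
  (λ p^α∣kCj → ∀p^β∣k⇒∏p^β∣k primes p-injective (λ i → α i + ⌊log p i ⌋ n)
    (λ i → p^α∣kCj⇒p^[α+⌊log⌋n]∣k (primes i) (α i) (1≤α i) 1≤n n≤k (p^α∣kCj i)))
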